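{- For any positive integers $c$ and $k$, \[ M(ck)\le (2^{ck}-1)\cdot\frac{M(k)}{2^k-1}. \]
   Context: For a positive integer $m$, $M(m)$ denotes the maximum size of a union-free family of non-empty subsets of $[m]=\{1,\dots,m\}$, where a family is union-free if no member equals the union of one or more other members of the family. -}

module Defs where

open import Data.Bool using (true; false)
open import Data.Nat using (ℕ; _≤_)
open import Data.Fin using (Fin)
open import Data.Fin.Subset using (Subset; ⋃; Nonempty; _∉_)
open import Data.List using (List; []; _∷_; length; lookup)
open import Data.List.Relation.Unary.All using (All)
open import Data.List.Relation.Unary.Unique.Propositional using (Unique)
open import Data.Vec using ([]; _∷_)
open import Data.Product using (Σ; _×_)
open import Relation.Binary.PropositionalEquality using (_≡_; _≢_)

select : ∀ {m} (F : List (Subset m)) → Subset (length F) → List (Subset m)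
select []      []          = []
select (A ∷ F) (true ∷ S)  = A ∷ select F S
select (A ∷ F) (false ∷ S) = select F S

UnionFree : ∀ {m} → List (Subset m) → Set
UnionFree F =
  (i : Fin (length F)) (S : Subset (length F)) →
  Nonempty S → i ∉ S → ⋃ (select F S) ≢ lookup F i

UFFamily : (m : ℕ) → List (Subset m) → Set
UFFamily m F = Unique F × All Nonempty F × UnionFree F

IsM : ℕ → ℕ → Set
IsM m n =
  Σ (List (Subset m)) (λ F → UFFamily m F × length F ≡ n)
  × ((F : List (Subset m)) → UFFamily m F → length F ≤ n)

module Submission where

-- A union-free family on [k + m] splits into the members contained in [k] and those
-- meeting the last m points. The former is a union-free family on [k], so it has at
-- most M(k) members. The latter fall into 2^k classes according to their trace on [k];
-- within a class, deleting the common trace is injective and preserves unions, so each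
-- class becomes a union-free family of nonempty subsets of [m], of size at most M(m).
-- Thus M(k + m) ≤ M(k) + 2^k M(m), and induction on c, with every bound multiplied by
-- 2^k − 1 to stay in ℕ, gives (2^k − 1) M(ck) ≤ (2^{ck} − 1) M(k) because
-- (2^k − 1) + 2^k (2^{(c−1)k} − 1) = 2^{ck} − 1.

open import Defs
open import Data.Nat using (ℕ; zero; suc; _+_; _*_; _∸_; _^_; _≤_; z≤n)
open import Data.Nat.Properties
  using (≤-trans; ≤-reflexive; +-mono-≤; *-monoˡ-≤; *-identityˡ; *-distribʳ-+; +-suc; m^n>0; ^-distribˡ-+-*)
open Data.Nat.Properties.≤-Reasoning
open import Data.Nat.Tactic.RingSolver using (solve-∀)
open import Data.Bool using (true; false; T; _∨_)
open import Data.Bool.Properties using (∨-idem; T?)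
open import Data.Fin using () renaming (zero to fzero; suc to fsuc)
open import Data.Fin.Subset using (Subset; ⋃; Nonempty; _∉_; ⊥; _∪_)
open import Data.Fin.Subset.Properties using (nonempty?; Empty-unique; ∪-identityʳ; ∪-idem)
open import Data.List using (List; []; _∷_; length; lookup; map; filter)
open import Data.List.Properties using (length-map; map-∘; map-id-local)
open import Data.List.Relation.Binary.Sublist.Propositional using (_⊆_; []; _∷_; _∷ʳ_; ⊆-trans)
open import Data.List.Relation.Binary.Sublist.Propositional.Properties using (map⁺; filter-⊆)
open import Data.List.Relation.Unary.All as All using (All; _∷_)
open import Data.List.Relation.Unary.All.Properties as All using (all-filter)
open import Data.List.Relation.Unary.Unique.Propositional using (Unique)
open import Data.List.Relation.Unary.Unique.Propositional.Properties as Unique using ()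
open import Data.Vec using ([]; _∷_; _++_; head; tail; take; drop)
open import Data.Vec.Base using (here; there)
open import Data.Vec.Properties using (take++drop≡id; zipWith-++)
open import Data.Product using (Σ; _×_; _,_; ∃₂)
import Data.Product as Product
open import Function using (_∘_; id; _⇔_; mk⇔; Equivalence)
open import Relation.Nullary using (¬_; yes; no; contradiction)
open import Relation.Unary using (Decidable)
open import Relation.Unary.Properties using (∁?)
open import Relation.Binary.PropositionalEquality using (_≡_; _≢_; refl; sym; trans; cong; cong₂; subst)

-- Unlike the
-- index-based UnionFree of Defs, union-freeness phrased with Pick passes to sub-lists
-- and pulls back along ∪-preserving maps by a direct recursion on Pick.
data Pick {X : Set} : List X → X → List X → Set where
  here : ∀ {A F Bs} → Bs ⊆ F → Pick (A ∷ F) A Bs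
  keep : ∀ {A B F Bs} → Pick F A Bs → Pick (B ∷ F) A (B ∷ Bs)
  skip : ∀ {A B F Bs} → Pick F A Bs → Pick (B ∷ F) A Bs

UnionFree′ : ∀ {m} → List (Subset m) → Set
UnionFree′ F = ∀ {A B Bs} → Pick F A (B ∷ Bs) → ⋃ (B ∷ Bs) ≢ A

Pick-⊆ : ∀ {X : Set} {F G : List X} {A Bs} → G ⊆ F → Pick G A Bs → Pick F A Bs
Pick-⊆ (_ ∷ʳ G⊆F)   p           = skip (Pick-⊆ G⊆F p)
Pick-⊆ (refl ∷ G⊆F) (here Bs⊆G) = here (⊆-trans Bs⊆G G⊆F)
Pick-⊆ (refl ∷ G⊆F) (keep p)    = keep (Pick-⊆ G⊆F p)
Pick-⊆ (refl ∷ G⊆F) (skip p)    = skip (Pick-⊆ G⊆F p)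

Pick-map : ∀ {X Y : Set} (f : X → Y) {F A Bs} → Pick F A Bs → Pick (map f F) (f A) (map f Bs)
Pick-map f (here Bs⊆F) = here (map⁺ f Bs⊆F)
Pick-map f (keep p)    = keep (Pick-map f p)
Pick-map f (skip p)    = skip (Pick-map f p)

module _ {m : ℕ} where

  ⊆⇒select : ∀ (F : List (Subset m)) {Bs} → Bs ⊆ F → Σ (Subset (length F)) λ S → select F S ≡ Bs
  ⊆⇒select []      []            = [] , refl
  ⊆⇒select (A ∷ F) (_ ∷ʳ Bs⊆F)   = Product.map (false ∷_) id (⊆⇒select F Bs⊆F)
  ⊆⇒select (A ∷ F) (refl ∷ Bs⊆F) = Product.map (true ∷_) (cong (A ∷_)) (⊆⇒select F Bs⊆F)

  select-⊆ : ∀ (F : List (Subset m)) S → select F S ⊆ F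
  select-⊆ []      []          = []
  select-⊆ (A ∷ F) (true ∷ S)  = refl ∷ select-⊆ F S
  select-⊆ (A ∷ F) (false ∷ S) = A ∷ʳ select-⊆ F S

  Pick⇒select : ∀ (F : List (Subset m)) {A Bs} → Pick F A Bs →
    ∃₂ λ i S → i ∉ S × lookup F i ≡ A × select F S ≡ Bs
  Pick⇒select (A ∷ F) (here Bs⊆F) with ⊆⇒select F Bs⊆F
  ... | S , eq = fzero , false ∷ S , (λ ()) , refl , eq
  Pick⇒select (B ∷ F) (keep p) with Pick⇒select F p
  ... | i , S , i∉S , eqA , eqBs =
    fsuc i , true ∷ S , (λ { (there i∈S) → i∉S i∈S }) , eqA , cong (B ∷_) eqBs
  Pick⇒select (B ∷ F) (skip p) with Pick⇒select F p
  ... | i , S , i∉S , eqA , eqBs =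
    fsuc i , false ∷ S , (λ { (there i∈S) → i∉S i∈S }) , eqA , eqBs

  select-Pick : ∀ (F : List (Subset m)) i S → i ∉ S → Pick F (lookup F i) (select F S)
  select-Pick (A ∷ F) fzero    (true ∷ S)  i∉S = contradiction here i∉S
  select-Pick (A ∷ F) fzero    (false ∷ S) i∉S = here (select-⊆ F S)
  select-Pick (A ∷ F) (fsuc i) (true ∷ S)  i∉S = keep (select-Pick F i S (i∉S ∘ there))
  select-Pick (A ∷ F) (fsuc i) (false ∷ S) i∉S = skip (select-Pick F i S (i∉S ∘ there))

  select≡∷⇒Nonempty : ∀ (F : List (Subset m)) S {B Bs} → select F S ≡ B ∷ Bs → Nonempty S
  select≡∷⇒Nonempty []      []          ()
  select≡∷⇒Nonempty (A ∷ F) (true ∷ S)  _  = fzero , here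
  select≡∷⇒Nonempty (A ∷ F) (false ∷ S) eq = Product.map fsuc there (select≡∷⇒Nonempty F S eq)

  Nonempty⇒select≡∷ : ∀ (F : List (Subset m)) S → Nonempty S → ∃₂ λ B Bs → select F S ≡ B ∷ Bs
  Nonempty⇒select≡∷ (A ∷ F) (true ∷ S)  _                  = A , select F S , refl
  Nonempty⇒select≡∷ (A ∷ F) (false ∷ S) (fsuc i , there x) = Nonempty⇒select≡∷ F S (i , x)

  UnionFree⇒UnionFree′ : ∀ {F : List (Subset m)} → UnionFree F → UnionFree′ F
  UnionFree⇒UnionFree′ {F} uf p eq with Pick⇒select F p
  ... | i , S , i∉S , eqA , eqBs =
    uf i S (select≡∷⇒Nonempty F S eqBs) i∉S (trans (cong ⋃ eqBs) (trans eq (sym eqA)))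

  UnionFree′⇒UnionFree : ∀ {F : List (Subset m)} → UnionFree′ F → UnionFree F
  UnionFree′⇒UnionFree {F} uf i S S≠∅ i∉S with Nonempty⇒select≡∷ F S S≠∅ | select-Pick F i S i∉S
  ... | B , Bs , eq | p rewrite eq = uf p

UFFamily′ : (m : ℕ) → List (Subset m) → Set
UFFamily′ m F = Unique F × All Nonempty F × UnionFree′ F

UFFamily⇔UFFamily′ : ∀ {m} {F : List (Subset m)} → UFFamily m F ⇔ UFFamily′ m F
UFFamily⇔UFFamily′ = mk⇔ (Product.map₂ (Product.map₂ UnionFree⇒UnionFree′))
                         (Product.map₂ (Product.map₂ UnionFree′⇒UnionFree))

Preserves-∪ : ∀ {m n} → (Subset m → Subset n) → Set
Preserves-∪ e = ∀ x y → e (x ∪ y) ≡ e x ∪ e y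

-- Only nonempty unions: b ∷_ does not preserve ⊥.
⋃-map : ∀ {m n} {e : Subset m → Subset n} → Preserves-∪ e →
  ∀ B Bs → e (⋃ (B ∷ Bs)) ≡ ⋃ (map e (B ∷ Bs))
⋃-map {e = e} e-∪ B []         = trans (cong e (∪-identityʳ B)) (sym (∪-identityʳ (e B)))
⋃-map {e = e} e-∪ B (B′ ∷ Bs) = trans (e-∪ B (⋃ (B′ ∷ Bs))) (cong (e B ∪_) (⋃-map e-∪ B′ Bs))

UnionFree′-⊆ : ∀ {m} {F G : List (Subset m)} → G ⊆ F → UnionFree′ F → UnionFree′ G
UnionFree′-⊆ G⊆F uf = uf ∘ Pick-⊆ G⊆F

UnionFree′-map⁻ : ∀ {m n} {e : Subset m → Subset n} {G} → Preserves-∪ e →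
  UnionFree′ (map e G) → UnionFree′ G
UnionFree′-map⁻ {e = e} e-∪ uf {B = B} {Bs} p eq =
  uf (Pick-map e p) (trans (sym (⋃-map e-∪ B Bs)) (cong e eq))

UFFamily′-filter : ∀ {m} {P : Subset m → Set} (P? : Decidable P) {F} →
  UFFamily′ m F → UFFamily′ m (filter P? F)
UFFamily′-filter P? {F} (unique , nonempty , uf) =
  Unique.filter⁺ P? unique , All.filter⁺ P? nonempty , UnionFree′-⊆ (filter-⊆ P? F) uf

UFFamily′-map⁻ : ∀ {m n} {e : Subset m → Subset n} {G} → Preserves-∪ e →
  All Nonempty G → UFFamily′ n (map e G) → UFFamily′ m G
UFFamily′-map⁻ e-∪ nonempty (unique , _ , uf) =
  Unique.map⁻ unique , nonempty , UnionFree′-map⁻ e-∪ uf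

UFFamily′-filter-map : ∀ {m n} {P : Subset n → Set} (P? : Decidable P)
  (π : Subset n → Subset m) (e : Subset m → Subset n) →
  (∀ {A} → P A → e (π A) ≡ A) → Preserves-∪ e →
  ∀ {F} → UFFamily′ n F → All Nonempty (map π (filter P? F)) → UFFamily′ m (map π (filter P? F))
UFFamily′-filter-map P? π e e∘π≗id e-∪ {F} family nonempty =
  UFFamily′-map⁻ e-∪ nonempty (subst (UFFamily′ _) (sym e∘π∘filter) (UFFamily′-filter P? family))
  where
  e∘π∘filter : map e (map π (filter P? F)) ≡ filter P? F
  e∘π∘filter = trans (sym (map-∘ (filter P? F)))
                     (map-id-local (All.map e∘π≗id (all-filter P? F)))

length-filter-∁ : ∀ {X : Set} {P : X → Set} (P? : Decidable P) xs →
  length xs ≡ length (filter P? xs) + length (filter (∁? P?) xs)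
length-filter-∁ P? []       = refl
length-filter-∁ P? (x ∷ xs) with P? x
... | yes _ = cong suc (length-filter-∁ P? xs)
... | no _  = trans (cong suc (length-filter-∁ P? xs)) (sym (+-suc _ _))

∷-preserves-∪ : ∀ {m} b → Preserves-∪ {m} (b ∷_)
∷-preserves-∪ b x y = cong (_∷ (x ∪ y)) (sym (∨-idem b))

++⊥-preserves-∪ : ∀ {k m} → Preserves-∪ {k} (_++ ⊥ {m})
++⊥-preserves-∪ x y = sym (trans (zipWith-++ _∨_ x ⊥ y ⊥) (cong ((x ∪ y) ++_) (∪-idem ⊥)))

Nonempty-drop⇒Nonempty : ∀ j {m} (A : Subset (j + m)) → Nonempty (drop j A) → Nonempty A
Nonempty-drop⇒Nonempty zero    A       = id
Nonempty-drop⇒Nonempty (suc j) (b ∷ A) = Product.map fsuc there ∘ Nonempty-drop⇒Nonempty j A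

Nonempty-take : ∀ k {m} (A : Subset (k + m)) → Nonempty A → ¬ Nonempty (drop k A) → Nonempty (take k A)
Nonempty-take zero    A           A≠∅                ∅ = contradiction A≠∅ ∅
Nonempty-take (suc k) (true ∷ A)  _                  _ = fzero , here
Nonempty-take (suc k) (false ∷ A) (fsuc i , there x) ∅ = Product.map fsuc there (Nonempty-take k A (i , x) ∅)

WeightedBound : ℕ → ℕ → ℕ → Set
WeightedBound m d B = ∀ F → UFFamily′ m F → length F * d ≤ B

tail-UFFamily′ : ∀ j {m} b {P : Subset (suc (j + m)) → Set} (P? : Decidable P) →
  (∀ {A} → P A → b ∷ tail A ≡ A) →
  ∀ {F} → UFFamily′ (suc (j + m)) F → All (Nonempty ∘ drop (suc j)) F →
  UFFamily′ (j + m) (map tail (filter P? F)) × All (Nonempty ∘ drop j) (map tail (filter P? F))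
tail-UFFamily′ j {m} b P? b∷tail≡id {F} family drops≠∅ =
  UFFamily′-filter-map P? tail (b ∷_) b∷tail≡id (∷-preserves-∪ b) family
    (All.map (Nonempty-drop⇒Nonempty j _) drops′≠∅) ,
  drops′≠∅
  where
  drop-tail : ∀ {A : Subset (suc (j + m))} → Nonempty (drop (suc j) A) → Nonempty (drop j (tail A))
  drop-tail {_ ∷ _} ne = ne
  drops′≠∅ : All (Nonempty ∘ drop j) (map tail (filter P? F))
  drops′≠∅ = All.map⁺ (All.map (λ {A} → drop-tail {A}) (All.filter⁺ P? drops≠∅))

2*m*n≡m*n+m*n : ∀ m n → 2 * m * n ≡ m * n + m * n
2*m*n≡m*n+m*n = solve-∀

head-true : ∀ {n} {A : Subset (suc n)} → T (head A) → true ∷ tail A ≡ A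
head-true {A = true ∷ _} _ = refl

head-false : ∀ {n} {A : Subset (suc n)} → ¬ T (head A) → false ∷ tail A ≡ A
head-false {A = false ∷ _} _      = refl
head-false {A = true ∷ _}  ¬true = contradiction _ ¬true

dropNonempty-weightedBound : ∀ j {m d B} → WeightedBound m d B →
  ∀ F → UFFamily′ (j + m) F → All (Nonempty ∘ drop j) F → length F * d ≤ 2 ^ j * B
dropNonempty-weightedBound zero    {B = B} bound F family _ =
  ≤-trans (bound F family) (≤-reflexive (sym (*-identityˡ B)))
dropNonempty-weightedBound (suc j) {m} {d} {B} bound F family drops≠∅ = begin
  length F * d                   ≡⟨ cong (_* d) split ⟩
  (length F₁ + length F₀) * d    ≡⟨ *-distribʳ-+ d (length F₁) (length F₀) ⟩
  length F₁ * d + length F₀ * d  ≤⟨ +-mono-≤ (ih true P? head-true) (ih false (∁? P?) head-false) ⟩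
  2 ^ j * B + 2 ^ j * B          ≡⟨ sym (2*m*n≡m*n+m*n (2 ^ j) B) ⟩
  2 ^ suc j * B                  ∎
  where
  P? = T? ∘ head
  F₁ = map tail (filter P? F)
  F₀ = map tail (filter (∁? P?) F)
  split : length F ≡ length F₁ + length F₀
  split = trans (length-filter-∁ P? F)
    (sym (cong₂ _+_ (length-map tail (filter P? F)) (length-map tail (filter (∁? P?) F))))
  ih : ∀ b {Q} (Q? : Decidable Q) → (∀ {A} → Q A → b ∷ tail A ≡ A) →
       length (map tail (filter Q? F)) * d ≤ 2 ^ j * B
  ih b Q? b∷tail≡id = Product.uncurry (dropNonempty-weightedBound j bound _)
                                      (tail-UFFamily′ j b Q? b∷tail≡id family drops≠∅)

weightedBound-+ : ∀ k {m d Mk B} → (∀ G → UFFamily′ k G → length G ≤ Mk) → WeightedBound m d B →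
  WeightedBound (k + m) d (2 ^ k * B + Mk * d)
weightedBound-+ k {m} {d} {Mk} {B} maximal bound F family@(_ , nonempty , _) = begin
  length F * d                      ≡⟨ cong (_* d) (length-filter-∁ P? F) ⟩
  (length F₊ + length F₀) * d       ≡⟨ *-distribʳ-+ d (length F₊) (length F₀) ⟩
  length F₊ * d + length F₀ * d     ≤⟨ +-mono-≤ drops-bound (*-monoˡ-≤ d heads-bound) ⟩
  2 ^ k * B + Mk * d                ∎
  where
  P? = nonempty? ∘ drop k
  F₊ = filter P? F
  F₀ = filter (∁? P?) F
  take++⊥ : ∀ {A} → ¬ Nonempty (drop k A) → take k A ++ ⊥ ≡ A
  take++⊥ {A} ∅ = trans (cong (take k A ++_) (sym (Empty-unique ∅))) (take++drop≡id k A)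
  heads≠∅ : All Nonempty (map (take k) F₀)
  heads≠∅ = All.map⁺ (All.zipWith (Product.uncurry (Nonempty-take k _))
                                   (All.filter⁺ (∁? P?) nonempty , all-filter (∁? P?) F))
  drops-bound : length F₊ * d ≤ 2 ^ k * B
  drops-bound = dropNonempty-weightedBound k bound F₊ (UFFamily′-filter P? family) (all-filter P? F)
  heads-bound : length F₀ ≤ Mk
  heads-bound = subst (_≤ Mk) (length-map (take k) F₀)
    (maximal _ (UFFamily′-filter-map (∁? P?) (take k) (_++ ⊥) take++⊥ ++⊥-preserves-∪
                                      family heads≠∅))

∸1-split : ∀ {a b} → 1 ≤ a → 1 ≤ b → ∀ M → a * ((b ∸ 1) * M) + M * (a ∸ 1) ≡ (a * b ∸ 1) * M
∸1-split {suc a} {suc b} _ _ = identity a b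
  where
  identity : ∀ a b M → suc a * (b * M) + M * a ≡ (b + a * suc b) * M
  identity = solve-∀

weightedBound-* : ∀ c {k Mk} → (∀ G → UFFamily′ k G → length G ≤ Mk) →
  WeightedBound (c * k) (2 ^ k ∸ 1) ((2 ^ (c * k) ∸ 1) * Mk)
weightedBound-* zero    maximal []      _ = z≤n
weightedBound-* zero    maximal (_ ∷ _) (_ , ((() , _) ∷ _) , _)
weightedBound-* (suc c) {k} {Mk} maximal =
  subst (WeightedBound (k + c * k) (2 ^ k ∸ 1)) total
    (weightedBound-+ k maximal (weightedBound-* c maximal))
  where
  total : 2 ^ k * ((2 ^ (c * k) ∸ 1) * Mk) + Mk * (2 ^ k ∸ 1) ≡ (2 ^ (k + c * k) ∸ 1) * Mk
  total = trans (∸1-split (m^n>0 2 k) (m^n>0 2 (c * k)) Mk)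
                (cong (λ x → (x ∸ 1) * Mk) (sym (^-distribˡ-+-* 2 k (c * k))))

mainTheorem8 : (c k : ℕ) → 1 ≤ c → 1 ≤ k → (Mck Mk : ℕ) →
    IsM (c * k) Mck → IsM k Mk →
    Mck * (2 ^ k ∸ 1) ≤ (2 ^ (c * k) ∸ 1) * Mk
mainTheorem8 c k _ _ _ Mk ((F , family , refl) , _) (_ , maximal) =
  weightedBound-* c (λ G → maximal G ∘ Equivalence.from UFFamily⇔UFFamily′) F
    (Equivalence.to UFFamily⇔UFFamily′ family)
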